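{- Let $G$ be a finite simple graph and let $T$ be a minimum twin cover of $G$, with image $\widetilde T = \{[x] : x \in T\}$ in the quotient graph $\widetilde G$. Suppose $\widetilde\alpha$ is an automorphism of $\widetilde G$ that fixes each element of $\widetilde T$. Then there exists an automorphism $\alpha$ of $G$ that fixes each vertex of $T$ and induces $\widetilde\alpha$, i.e. $\widetilde\alpha([v]) = [\alpha(v)]$ for all $v \in V(G)$.
   Context: Two vertices are twins if they have the same open neighborhood. Define $x \sim y$ if $x = y$ or $x,y$ are twins; this is an equivalence relation with classes $[x]$. The quotient graph $\widetilde G$ has the equivalence classes as vertices, with $[x]$ adjacent to $[z]$ iff $x$ is adjacent to $z$ in $G$. A minimum twin cover of $G$ is a minimum size subset of $V(G)$ containing at least one vertex from every pair of twin vertices (equivalently, all but one vertex from each equivalence class). Every automorphism $\alpha$ of $G$ induces the automorphism $[x]\mapsto[\alpha(x)]$ of $\widetilde G$. -}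

module Defs where

open import Data.Nat using (ℕ; _≤_)
open import Data.Bool using (Bool; true; false)
open import Data.Fin using (Fin)
open import Data.Fin.Subset using (Subset; _∈_; ∣_∣)
open import Data.Product using (Σ; ∃; _×_; _,_)
open import Data.Sum using (_⊎_)
open import Relation.Binary.PropositionalEquality using (_≡_; _≢_)
open import Function.Definitions using (Bijective)
open import Function.Bundles using (_⇔_)

record Graph (n : ℕ) : Set where
  field
    adj   : Fin n → Fin n → Bool
    sym   : ∀ x y → adj x y ≡ adj y x
    loopless : ∀ x → adj x x ≡ false
open Graph public

Adj : ∀ {n} → Graph n → Fin n → Fin n → Set
Adj G x y = adj G x y ≡ true

Twins : ∀ {n} → Graph n → Fin n → Fin n → Set
Twins G x y = x ≢ y × (∀ z → (Adj G x z ⇔ Adj G y z))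

_∼[_]_ : ∀ {n} → Fin n → Graph n → Fin n → Set
x ∼[ G ] y = x ≡ y ⊎ Twins G x y

IsTwinCover : ∀ {n} → Graph n → Subset n → Set
IsTwinCover G T = ∀ x y → Twins G x y → (x ∈ T) ⊎ (y ∈ T)

IsMinimumTwinCover : ∀ {n} → Graph n → Subset n → Set
IsMinimumTwinCover G T =
  IsTwinCover G T × (∀ T' → IsTwinCover G T' → ∣ T ∣ ≤ ∣ T' ∣)

IsAutomorphism : ∀ {n} → Graph n → (Fin n → Fin n) → Set
IsAutomorphism G α = Bijective _≡_ _≡_ α × (∀ x y → adj G (α x) (α y) ≡ adj G x y)

-- Automorphism of the quotient graph G̃, represented (no quotient types) by a
-- map f on vertices of G acting on classes: f respects ∼, is a bijection on
-- ∼-classes, and [x] ~ [z] adjacent in G̃ iff [f x], [f z] adjacent, where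
-- [x] adj [z] in G̃ iff x adj z in G.
record IsQuotientAutomorphism {n} (G : Graph n) (f : Fin n → Fin n) : Set where
  field
    respects   : ∀ x y → x ∼[ G ] y → f x ∼[ G ] f y
    injective  : ∀ x y → f x ∼[ G ] f y → x ∼[ G ] y
    surjective : ∀ y → ∃ λ x → f x ∼[ G ] y
    preserves  : ∀ x z → adj G (f x) (f z) ≡ adj G x z

-- Every vertex v with a twin w has v or w in the twin cover T, so its class
-- [v] = [w] is fixed by α̃. Hence α̃ only moves classes of twinless vertices,
-- which are singletons, onto other singletons. So α can be taken to be the
-- identity on vertices with a twin and to follow α̃ on twinless vertices;
-- adjacency is preserved because it only depends on the classes.
module Submission where

open import Defs hiding (sym)
open import Data.Fin using (Fin)
open import Data.Fin.Subset using (Subset; _∈_)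
open import Data.Fin.Properties using (any?; all?) renaming (_≟_ to _≟ᶠ_)
open import Data.Bool using (Bool; true)
open import Data.Bool.Properties using (⇔→≡) renaming (_≟_ to _≟ᵇ_)
open import Data.Product using (Σ; ∃; _×_; _,_; proj₁; proj₂)
open import Data.Sum using (inj₁; inj₂)
open import Data.Empty using (⊥-elim)
open import Function.Bundles using (_⇔_; mk⇔)
import Function.Properties.Equivalence as ⇔
open import Relation.Nullary using (¬_; Dec; yes; no)
open import Relation.Nullary.Decidable using (map′; ¬?; _×-dec_)
open import Relation.Binary.PropositionalEquality
  using (_≡_; refl; sym; trans; subst)

module _ {n} (G : Graph n) where

  Twins-sym : ∀ {x y} → Twins G x y → Twins G y x
  Twins-sym (x≢y , same) = (λ y≡x → x≢y (sym y≡x)) , λ z → ⇔.sym (same z)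

  ∼-sym : ∀ {x y} → x ∼[ G ] y → y ∼[ G ] x
  ∼-sym (inj₁ x≡y) = inj₁ (sym x≡y)
  ∼-sym (inj₂ tw)  = inj₂ (Twins-sym tw)

  ∼-trans : ∀ {x y z} → x ∼[ G ] y → y ∼[ G ] z → x ∼[ G ] z
  ∼-trans (inj₁ refl) y∼z = y∼z
  ∼-trans x∼y (inj₁ refl) = x∼y
  ∼-trans {x} {z = z} (inj₂ (_ , xy)) (inj₂ (_ , yz)) with x ≟ᶠ z
  ... | yes x≡z = inj₁ x≡z
  ... | no  x≢z = inj₂ (x≢z , λ w → ⇔.trans (xy w) (yz w))

  adj-congˡ : ∀ {x x'} z → x ∼[ G ] x' → adj G x z ≡ adj G x' z
  adj-congˡ z (inj₁ refl)       = refl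
  adj-congˡ z (inj₂ (_ , same)) = ⇔→≡ (same z)

  adj-cong : ∀ {x x' y y'} → x ∼[ G ] x' → y ∼[ G ] y' → adj G x y ≡ adj G x' y'
  adj-cong {x} {x'} {y} {y'} x∼x' y∼y' =
    trans (adj-congˡ y x∼x')
      (trans (Graph.sym G x' y) (trans (adj-congˡ x' y∼y') (Graph.sym G y' x')))

  twins? : ∀ x y → Dec (Twins G x y)
  twins? x y =
    ¬? (x ≟ᶠ y) ×-dec map′ (λ rows z → Adj-⇔ (rows z)) (λ same z → ⇔→≡ (same z))
                            (all? λ z → adj G x z ≟ᵇ adj G y z)
    where
    Adj-⇔ : ∀ {a b : Bool} → a ≡ b → a ≡ true ⇔ b ≡ true
    Adj-⇔ a≡b = mk⇔ (trans (sym a≡b)) (trans a≡b)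

  HasTwin : Fin n → Set
  HasTwin v = ∃ λ w → Twins G v w

  hasTwin? : ∀ v → Dec (HasTwin v)
  hasTwin? v = any? (twins? v)

  ∼-twinless⇒≡ : ∀ {x y} → ¬ HasTwin y → x ∼[ G ] y → x ≡ y
  ∼-twinless⇒≡ _        (inj₁ x≡y) = x≡y
  ∼-twinless⇒≡ {x} noTw (inj₂ tw)  = ⊥-elim (noTw (x , Twins-sym tw))

  module Lift (T : Subset n) (cover : IsTwinCover G T)
              (f : Fin n → Fin n) (f̃ : IsQuotientAutomorphism G f)
              (f-fixes-T : ∀ t → t ∈ T → f t ∼[ G ] t) where
    open IsQuotientAutomorphism f̃

    f-fixes-twinned : ∀ v → HasTwin v → f v ∼[ G ] v
    f-fixes-twinned v (w , tw) with cover v w tw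
    ... | inj₁ v∈T = f-fixes-T v v∈T
    ... | inj₂ w∈T =
      ∼-trans (respects v w (inj₂ tw)) (∼-trans (f-fixes-T w w∈T) (inj₂ (Twins-sym tw)))

    lift : Fin n → Fin n
    lift v with hasTwin? v
    ... | yes _ = v
    ... | no  _ = f v

    lift-twinned : ∀ v → HasTwin v → lift v ≡ v
    lift-twinned v tw with hasTwin? v
    ... | yes _  = refl
    ... | no  ¬tw = ⊥-elim (¬tw tw)

    lift-induces : ∀ v → f v ∼[ G ] lift v
    lift-induces v with hasTwin? v
    ... | yes tw = f-fixes-twinned v tw
    ... | no  _  = inj₁ refl

    lift-fixes-T : ∀ t → t ∈ T → lift t ≡ t
    lift-fixes-T t t∈T with hasTwin? t
    ... | yes _   = refl
    ... | no  ¬tw = ∼-twinless⇒≡ ¬tw (f-fixes-T t t∈T)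

    lift-injective : ∀ {x y} → lift x ≡ lift y → x ≡ y
    lift-injective {x} {y} eq
      with injective x y
             (∼-trans (subst (f x ∼[ G ]_) eq (lift-induces x)) (∼-sym (lift-induces y)))
    ... | inj₁ x≡y = x≡y
    ... | inj₂ tw  =
      trans (sym (lift-twinned x (y , tw))) (trans eq (lift-twinned y (x , Twins-sym tw)))

    lift-surjective : ∀ y → ∃ λ x → lift x ≡ y
    lift-surjective y with hasTwin? y | surjective y
    ... | yes tw  | _         = y , lift-twinned y tw
    ... | no  ¬tw | x , fx∼y  = x , ∼-twinless⇒≡ ¬tw (∼-trans (∼-sym (lift-induces x)) fx∼y)

    lift-automorphism : IsAutomorphism G lift
    lift-automorphism =
      ( lift-injective
      , λ y → proj₁ (lift-surjective y) , λ { refl → proj₂ (lift-surjective y) } )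
      , λ x y → trans (adj-cong (∼-sym (lift-induces x)) (∼-sym (lift-induces y)))
                      (preserves x y)

lemma4 : ∀ {n} (G : Graph n) (T : Subset n) → IsMinimumTwinCover G T →
    (f : Fin n → Fin n) → IsQuotientAutomorphism G f →
    (∀ t → t ∈ T → f t ∼[ G ] t) →
    Σ (Fin n → Fin n) λ α → IsAutomorphism G α × (∀ t → t ∈ T → α t ≡ t) ×
      (∀ v → f v ∼[ G ] α v)
lemma4 G T (cover , _) f f̃ f-fixes-T =
  lift , lift-automorphism , lift-fixes-T , lift-induces
  where open Lift G T cover f f̃ f-fixes-T
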